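{- Let $G$ be a connected graph and let $\{C_1,\dots, C_k\}$ be the partition of $\mathcal{S}(G)$ into true twin equivalence classes. If $\mu_t(G)=|\mathcal{S}(G)|$, then for any integer $n\ge 2$ $$\mu_t(G\Box K_n)=\sum_{i=1}^k \max\{|C_i|,n\}.$$
   Context: All graphs are finite, simple and undirected. A vertex is simplicial if its neighbours induce a complete graph; $\mathcal{S}(G)$ is the set of simplicial vertices of $G$. Two simplicial vertices $g,g'$ are in the same true twin class iff $N_G[g]=N_G[g']$ (closed neighbourhoods). $K_n$ is the complete graph on $n$ vertices. The Cartesian product $G\Box H$ has vertex set $V(G)\times V(H)$, with $(x,y)$ adjacent to $(x',y')$ iff either $x=x'$ and $yy'\in E(H)$, or $xx'\in E(G)$ and $y=y'$. For a graph $F$ and $X\subseteq V(F)$, two vertices $x,y$ are $X$-visible if there is a shortest $x,y$-path in $F$ none of whose internal vertices lies in $X$. $X$ is a total mutual-visibility set of $F$ if every two vertices of $F$ are $X$-visible; $\mu_t(F)$ is the maximum cardinality of such a set. -}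

module Defs where

open import Data.Bool using (Bool; true; false; _∧_; _∨_; not)
open import Data.Nat using (ℕ; zero; suc; _+_; _*_; _≤_; _<_; _⊔_)
open import Data.Fin using (Fin; remQuot; _≟_; toℕ)
open import Data.Fin.Properties using (all?)
open import Data.Fin.Subset using (Subset; _∈_; _∉_; ∣_∣)
open import Data.Vec using (tabulate)
import Data.Vec.Properties as VecP
import Data.Bool.Properties as BoolP
open import Data.List using (List; []; _∷_; map; allFin)
open import Data.Nat.ListAction using (sum)
open import Data.List.Relation.Unary.All using (All)
open import Data.Product using (Σ; ∃; ∃-syntax; _×_; _,_; proj₁; proj₂)
open import Relation.Nullary using (¬_; Dec; yes; no)
open import Relation.Nullary.Decidable using (isYes; ¬?; _→-dec_)
open import Relation.Binary.PropositionalEquality using (_≡_; _≢_)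

record Graph : Set where
  field
    order : ℕ
    adj   : Fin order → Fin order → Bool

open Graph public

IsSimple : Graph → Set
IsSimple G = (∀ x y → adj G x y ≡ adj G y x) × (∀ x → adj G x x ≡ false)

Adj : (G : Graph) → Fin (order G) → Fin (order G) → Set
Adj G x y = adj G x y ≡ true

K : ℕ → Graph
K n = record { order = n ; adj = λ i j → not (isYes (i ≟ j)) }

-- Cartesian product G □ H, vertex (x , y) encoded as an element of Fin (|G| * |H|)
_□_ : Graph → Graph → Graph
G □ H = record
  { order = order G * order H
  ; adj = λ i j →
      let x  = proj₁ (remQuot {order G} (order H) i)
          y  = proj₂ (remQuot {order G} (order H) i)
          x' = proj₁ (remQuot {order G} (order H) j)
          y' = proj₂ (remQuot {order G} (order H) j)
      in (isYes (x ≟ x') ∧ adj H y y') ∨ (adj G x x' ∧ isYes (y ≟ y'))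
  }

data Walk (G : Graph) : Fin (order G) → Fin (order G) → ℕ → Set where
  nil  : ∀ x → Walk G x x 0
  cons : ∀ {x y z l} → Adj G x y → Walk G y z l → Walk G x z (suc l)

interior : ∀ {G x y l} → Walk G x y l → List (Fin (order G))
interior (nil _) = []
interior (cons _ (nil _)) = []
interior (cons {y = y} _ (cons e w)) = y ∷ interior (cons e w)

Connected : Graph → Set
Connected G = ∀ x y → ∃[ l ] Walk G x y l

IsShortest : ∀ {G x y l} → Walk G x y l → Set
IsShortest {G} {x} {y} {l} _ = ∀ l' → Walk G x y l' → l ≤ l'

Visible : (G : Graph) → Subset (order G) → Fin (order G) → Fin (order G) → Set
Visible G X x y =
  ∃[ l ] Σ (Walk G x y l) (λ w → IsShortest w × All (_∉ X) (interior w))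

IsTotalMutualVisibility : (G : Graph) → Subset (order G) → Set
IsTotalMutualVisibility G X = ∀ x y → Visible G X x y

MuT≡ : Graph → ℕ → Set
MuT≡ G k =
  (∃[ X ] (IsTotalMutualVisibility G X × ∣ X ∣ ≡ k))
  × (∀ X → IsTotalMutualVisibility G X → ∣ X ∣ ≤ k)

Simplicial : (G : Graph) → Fin (order G) → Set
Simplicial G v = ∀ u w → Adj G v u → Adj G v w → u ≢ w → Adj G u w

simplicial? : (G : Graph) → (v : Fin (order G)) → Dec (Simplicial G v)
simplicial? G v = all? λ u → all? λ w →
  (adj G v u BoolP.≟ true) →-dec ((adj G v w BoolP.≟ true) →-dec
    ((¬? (u ≟ w)) →-dec (adj G u w BoolP.≟ true)))

S : (G : Graph) → Subset (order G)
S G = tabulate (λ v → isYes (simplicial? G v))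

N[_]_ : (G : Graph) → Fin (order G) → Subset (order G)
N[ G ] g = tabulate (λ u → isYes (g ≟ u) ∨ adj G g u)

TrueTwins : (G : Graph) → Fin (order G) → Fin (order G) → Set
TrueTwins G g g' = N[ G ] g ≡ N[ G ] g'

twins? : (G : Graph) → (g g' : Fin (order G)) → Dec (TrueTwins G g g')
twins? G g g' = VecP.≡-dec BoolP._≟_ (N[ G ] g) (N[ G ] g')

TwinClass : (G : Graph) → Fin (order G) → Subset (order G)
TwinClass G g = tabulate (λ g' → isYes (simplicial? G g') ∧ isYes (twins? G g g'))

IsRep : (G : Graph) → Fin (order G) → Set
IsRep G g = Simplicial G g × (∀ g' → toℕ g' < toℕ g → ¬ TrueTwins G g g')

isRep? : (G : Graph) → (g : Fin (order G)) → Dec (IsRep G g)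
isRep? G g with simplicial? G g
... | no ns = no (λ r → ns (proj₁ r))
... | yes s with all? (λ g' → (toℕ g' Data.Nat.<? toℕ g) →-dec ¬? (twins? G g g'))
...   | yes a = yes (s , a)
...   | no na = no (λ r → na (proj₂ r))

-- Σ_{i=1}^k max{|C_i|, n}, one summand per twin class (indexed by its representative)
twinClassSum : (G : Graph) → ℕ → ℕ
twinClassSum G n =
  sum (map (λ g → if′ isYes (isRep? G g) then ∣ TwinClass G g ∣ ⊔ n else 0) (allFin (order G)))
  where
  if′_then_else_ : Bool → ℕ → ℕ → ℕ
  if′ true then a else b = a
  if′ false then a else b = b

-- If ⟨x,i⟩ ∈ X with x non-simplicial, then layer i of X together with S(G) is a
-- total mutual-visibility set of G strictly larger than S(G), because shortest paths joining two
-- vertices of one layer stay in that layer and avoid simplicial vertices; so X lies over S(G).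
-- Two members of X over adjacent vertices lie in the same layer, since both shortest paths
-- across the square they span pass through members of X. True twins are adjacent, so in a
-- twin class C either one fibre carries two members of X and is then the only occupied one
-- (at most n members), or every fibre carries at most one (at most |C| members).
--
-- Put a class with |C| ≥ n into a single layer and replace a smaller class by its
-- representative in all n layers. Inner vertices of shortest paths are not simplicial, so a path
-- can change layer at one of them; only an edge xy joining ⟨x,i⟩ to ⟨y,j⟩ needs one of ⟨x,j⟩,
-- ⟨y,i⟩ to be free, and the construction never uses both.

module Submission where

open import Defs
open import Data.Nat using (ℕ; _≤_)
open import Data.Fin.Subset using (∣_∣)

open import Data.Bool using (Bool; true; false; _∧_; _∨_)
open import Data.Bool.Properties using (∨-zeroʳ)
open import Data.Empty using (⊥; ⊥-elim)
open import Data.Fin using (Fin; zero; suc; toℕ; combine; remQuot; _↑ˡ_; _↑ʳ_; _≟_)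
open import Data.Fin.Properties using (any?; <-cmp; remQuot-combine; combine-remQuot; suc-injective)
open import Data.Fin.Subset using (Subset; _∈_; _∉_; _⊆_; _⊂_; _∪_; ⁅_⁆; Nonempty)
open import Data.Fin.Subset.Properties
  using (_∈?_; ⊆-antisym; ⊆⊤; ∣⊤∣≡n; nonempty?; Empty-unique; ∣⊥∣≡0; ∣p∣≤n; p⊆q⇒∣p∣≤∣q∣;
         p⊂q⇒∣p∣<∣q∣; ∣⁅x⁆∣≡1; x∈⁅x⁆; x∈⁅y⁆⇒x≡y; q⊆p∪q; x∈p∪q⁻; x∈p∪q⁺)
open import Data.List using ([]; _∷_; map; allFin) renaming (tabulate to tabulateˡ)
open import Data.List.Properties using (map-tabulate)
open import Data.List.Membership.Propositional using () renaming (_∈_ to _∈ˡ_)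
open import Data.List.Relation.Unary.Any using (here; there)
open import Data.List.Relation.Unary.All as All using (All; []; _∷_)
import Data.List.Relation.Unary.All.Properties as Allₚ
open import Data.Nat using (zero; suc; _+_; _*_; _<_; _⊔_; z≤n; s≤s; _≤?_)
open import Data.Nat.Properties
  using (+-*-semiring; +-assoc; +-identityʳ; *-identityˡ; *-zeroʳ; +-mono-≤; +-monoʳ-<; *-monoʳ-≤;
         ≤-refl; ≤-trans; ≤-reflexive; ≤-pred; <⇒≤; <⇒≱; ≰⇒>; ≮⇒≥; >⇒≢; n≤0⇒n≡0; n<1+n;
         m≤n⇒m≤1+n; m<n⇒m<1+n; m≤m⊔n; m≤n⊔m; m≤n⇒m⊔n≡n; m≥n⇒m⊔n≡m; module ≤-Reasoning)
open import Data.Nat.ListAction using () renaming (sum to sumˡ)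
open import Data.Product using (Σ; ∃-syntax; _×_; _,_; proj₁; proj₂)
open import Data.Sum using (_⊎_; inj₁; inj₂)
open import Data.Vec using (lookup; tabulate; _∷_; [])
open import Data.Vec.Properties using (lookup∘tabulate; []=⇒lookup; lookup⇒[]=)
open import Function using (_∘_; case_of_)
open import Relation.Binary.PropositionalEquality
open import Relation.Binary.Definitions using (tri<; tri≈; tri>)
open import Relation.Nullary using (¬_; Dec; yes; no; contradiction)
open import Relation.Nullary.Decidable using (isYes; _×-dec_; _⊎-dec_)
open import Algebra.Properties.Semiring.Sum +-*-semiring
  using (sum; sum-syntax; sum-cong-≗; sum-replicate-zero; ∑-comm; *-distribˡ-sum)

𝟙 : Bool → ℕ
𝟙 true  = 1
𝟙 false = 0

𝟙*-≤ : ∀ b m → 𝟙 b * m ≤ m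
𝟙*-≤ true  m = ≤-reflexive (*-identityˡ m)
𝟙*-≤ false m = z≤n

𝟙*-cong : ∀ b {m m'} → (b ≡ true → m ≡ m') → 𝟙 b * m ≡ 𝟙 b * m'
𝟙*-cong true  m≡m' = cong (1 *_) (m≡m' refl)
𝟙*-cong false _    = refl

isYes⁺ : ∀ {A : Set} (A? : Dec A) → A → isYes A? ≡ true
isYes⁺ (yes _) _ = refl
isYes⁺ (no ¬a) a = contradiction a ¬a

isYes⁻ : ∀ {A : Set} (A? : Dec A) → isYes A? ≡ true → A
isYes⁻ (yes a) _ = a

isNo⁺ : ∀ {A : Set} (A? : Dec A) → ¬ A → isYes A? ≡ false
isNo⁺ (yes a) ¬a = contradiction a ¬a
isNo⁺ (no _)  _  = refl

∑-mono-≤ : ∀ {k} {f g : Fin k → ℕ} → (∀ i → f i ≤ g i) → ∑[ i < k ] f i ≤ ∑[ i < k ] g i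
∑-mono-≤ {zero}  f≤g = z≤n
∑-mono-≤ {suc k} f≤g = +-mono-≤ (f≤g zero) (∑-mono-≤ (f≤g ∘ suc))

∑-zero : ∀ {k} {f : Fin k → ℕ} → (∀ i → f i ≡ 0) → ∑[ i < k ] f i ≡ 0
∑-zero {k} f≡0 = trans (sum-cong-≗ f≡0) (sum-replicate-zero k)

∑-single : ∀ {k} {f : Fin k → ℕ} i → (∀ j → j ≢ i → f j ≡ 0) → ∑[ j < k ] f j ≡ f i
∑-single {suc k} {f} zero    others =
  trans (cong (f zero +_) (∑-zero (λ j → others (suc j) λ ()))) (+-identityʳ (f zero))
∑-single {suc k} {f} (suc i) others =
  trans (cong (_+ sum (f ∘ suc)) (others zero λ ()))
        (∑-single i (λ j j≢i → others (suc j) (j≢i ∘ suc-injective)))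

∑-++ : ∀ k l (f : Fin (k + l) → ℕ) → sum f ≡ ∑[ i < k ] f (i ↑ˡ l) + ∑[ j < l ] f (k ↑ʳ j)
∑-++ zero    l f = refl
∑-++ (suc k) l f = trans (cong (f zero +_) (∑-++ k l (f ∘ suc))) (sym (+-assoc (f zero) _ _))

∑-combine : ∀ m {n} (f : Fin (m * n) → ℕ) → sum f ≡ ∑[ x < m ] ∑[ j < n ] f (combine x j)
∑-combine zero        f = refl
∑-combine (suc m) {n} f =
  trans (∑-++ n (m * n) f) (cong (sum (f ∘ (_↑ˡ m * n)) +_) (∑-combine m (f ∘ (n ↑ʳ_))))

sumˡ-allFin : ∀ k (f : Fin k → ℕ) → sumˡ (map f (allFin k)) ≡ sum f
sumˡ-allFin zero    f = refl
sumˡ-allFin (suc k) f = cong (f zero +_) (begin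
    sumˡ (map f (tabulateˡ suc))     ≡⟨ cong sumˡ (map-tabulate suc f) ⟩
    sumˡ (tabulateˡ (f ∘ suc))       ≡⟨ cong sumˡ (sym (map-tabulate (λ i → i) (f ∘ suc))) ⟩
    sumˡ (map (f ∘ suc) (allFin k))           ≡⟨ sumˡ-allFin k (f ∘ suc) ⟩
    sum (f ∘ suc)                             ∎)
  where open ≡-Reasoning

∈-tabulate⁺ : ∀ {k} {f : Fin k → Bool} {i} → f i ≡ true → i ∈ tabulate f
∈-tabulate⁺ {f = f} {i} fi = lookup⇒[]= i (tabulate f) (trans (lookup∘tabulate f i) fi)

∈-tabulate⁻ : ∀ {k} {f : Fin k → Bool} {i} → i ∈ tabulate f → f i ≡ true
∈-tabulate⁻ {f = f} {i} i∈ = trans (sym (lookup∘tabulate f i)) ([]=⇒lookup i∈)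

∣p∣≡∑𝟙 : ∀ {k} (p : Subset k) → ∣ p ∣ ≡ ∑[ i < k ] 𝟙 (lookup p i)
∣p∣≡∑𝟙 []          = refl
∣p∣≡∑𝟙 (true  ∷ p) = cong suc (∣p∣≡∑𝟙 p)
∣p∣≡∑𝟙 (false ∷ p) = ∣p∣≡∑𝟙 p

∣tabulate∣≡∑𝟙 : ∀ {k} (f : Fin k → Bool) → ∣ tabulate f ∣ ≡ ∑[ i < k ] 𝟙 (f i)
∣tabulate∣≡∑𝟙 f = trans (∣p∣≡∑𝟙 (tabulate f)) (sum-cong-≗ (cong 𝟙 ∘ lookup∘tabulate f))

Empty⇒∣p∣≡0 : ∀ {k} (p : Subset k) → (∀ i → i ∉ p) → ∣ p ∣ ≡ 0
Empty⇒∣p∣≡0 {k} p empty = trans (cong ∣_∣ (Empty-unique λ (i , i∈p) → empty i i∈p)) (∣⊥∣≡0 k)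

Nonempty-∣p∣ : ∀ {k} (p : Subset k) → 0 < ∣ p ∣ → Nonempty p
Nonempty-∣p∣ p 0<∣p∣ with nonempty? p
... | yes ne = ne
... | no ¬ne = contradiction (Empty⇒∣p∣≡0 p λ i i∈p → ¬ne (i , i∈p)) (>⇒≢ 0<∣p∣)

∑-class-≤ : ∀ {m n} (C : Subset m) (r : Fin m → ℕ) → (∀ x → r x ≤ n) →
  (∀ x y → x ∈ C → y ∈ C → x ≢ y → 0 < r y → r x ≤ 1) →
  ∑[ x < m ] (𝟙 (lookup C x) * r x) ≤ ∣ C ∣ ⊔ n
∑-class-≤ {m} {n} C r r≤n exclusive with any? (λ x → (x ∈? C) ×-dec (2 ≤? r x))
... | yes (x₀ , x₀∈C , 2≤rx₀) = begin
  ∑[ x < m ] (𝟙 (lookup C x) * r x)  ≡⟨ ∑-single x₀ vanish ⟩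
  𝟙 (lookup C x₀) * r x₀           ≤⟨ 𝟙*-≤ (lookup C x₀) (r x₀) ⟩
  r x₀                             ≤⟨ r≤n x₀ ⟩
  n                                ≤⟨ m≤n⊔m ∣ C ∣ n ⟩
  ∣ C ∣ ⊔ n                        ∎
  where
  open ≤-Reasoning
  vanish : ∀ y → y ≢ x₀ → 𝟙 (lookup C y) * r y ≡ 0
  vanish y y≢x₀ with lookup C y in Cy
  ... | false = refl
  ... | true  = trans (*-identityˡ (r y)) (n≤0⇒n≡0 (≮⇒≥ λ 0<ry →
    <⇒≱ 2≤rx₀ (exclusive x₀ y x₀∈C (lookup⇒[]= y C Cy) (y≢x₀ ∘ sym) 0<ry)))
... | no none = begin
  ∑[ x < m ] (𝟙 (lookup C x) * r x)  ≤⟨ ∑-mono-≤ bounded ⟩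
  ∑[ x < m ] 𝟙 (lookup C x)        ≡⟨ ∣p∣≡∑𝟙 C ⟨
  ∣ C ∣                            ≤⟨ m≤m⊔n ∣ C ∣ n ⟩
  ∣ C ∣ ⊔ n                        ∎
  where
  open ≤-Reasoning
  bounded : ∀ x → 𝟙 (lookup C x) * r x ≤ 𝟙 (lookup C x)
  bounded x with lookup C x in Cx
  ... | false = z≤n
  ... | true  = ≤-trans (≤-reflexive (*-identityˡ (r x)))
                        (≤-pred (≰⇒> λ 2≤rx → none (x , lookup⇒[]= x C Cx , 2≤rx)))

∑-partition : ∀ {m} (R : Fin m → Bool) (C : Fin m → Subset m) (r : Fin m → ℕ) →
  (∀ x → 0 < r x → ∃[ g ] (R g ≡ true × x ∈ C g × (∀ g' → R g' ≡ true → x ∈ C g' → g' ≡ g))) →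
  ∑[ x < m ] r x ≡ ∑[ g < m ] (𝟙 (R g) * ∑[ x < m ] (𝟙 (lookup (C g) x) * r x))
∑-partition {m} R C r classified = begin
  ∑[ x < m ] r x                          ≡⟨ sum-cong-≗ select ⟨
  ∑[ x < m ] ∑[ g < m ] term g x          ≡⟨ ∑-comm (λ x g → term g x) ⟩
  ∑[ g < m ] ∑[ x < m ] term g x
    ≡⟨ sum-cong-≗ (λ g → *-distribˡ-sum (𝟙 (R g)) (λ x → 𝟙 (lookup (C g) x) * r x)) ⟨
  ∑[ g < m ] (𝟙 (R g) * ∑[ x < m ] (𝟙 (lookup (C g) x) * r x)) ∎
  where
  open ≡-Reasoning
  term : Fin m → Fin m → ℕ
  term g x = 𝟙 (R g) * (𝟙 (lookup (C g) x) * r x)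
  select : ∀ x → ∑[ g < m ] term g x ≡ r x
  select x with r x in rx
  ... | zero  = ∑-zero λ g →
    trans (cong (𝟙 (R g) *_) (*-zeroʳ (𝟙 (lookup (C g) x)))) (*-zeroʳ (𝟙 (R g)))
  ... | suc k with classified x (subst (0 <_) (sym rx) (s≤s z≤n))
  ...   | g , Rg , x∈Cg , unique = trans (∑-single g others) owner
    where
    owner : 𝟙 (R g) * (𝟙 (lookup (C g) x) * suc k) ≡ suc k
    owner rewrite Rg | []=⇒lookup x∈Cg = trans (*-identityˡ _) (*-identityˡ _)
    others : ∀ g' → g' ≢ g → 𝟙 (R g') * (𝟙 (lookup (C g') x) * suc k) ≡ 0
    others g' g'≢g with R g' in Rg' | lookup (C g') x in Cg'x
    ... | false | _     = refl
    ... | true  | false = refl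
    ... | true  | true  = contradiction (unique g' Rg' (lookup⇒[]= x (C g') Cg'x)) g'≢g

fibre : ∀ {m n} → Subset (m * n) → Fin m → Subset n
fibre p x = tabulate (λ j → lookup p (combine x j))

∈-fibre⁻ : ∀ {m n} {p : Subset (m * n)} {x : Fin m} {j : Fin n} → j ∈ fibre {m} p x → combine x j ∈ p
∈-fibre⁻ {p = p} {x} {j} j∈ =
  lookup⇒[]= (combine x j) p (∈-tabulate⁻ {f = λ j → lookup p (combine x j)} j∈)

∈-fibre⁺ : ∀ {m n} {p : Subset (m * n)} {x : Fin m} {j : Fin n} → combine x j ∈ p → j ∈ fibre {m} p x
∈-fibre⁺ {p = p} {x} xj∈ = ∈-tabulate⁺ {f = λ j → lookup p (combine x j)} ([]=⇒lookup xj∈)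

∣p∣≡∑∣fibre∣ : ∀ m {n} (p : Subset (m * n)) → ∣ p ∣ ≡ ∑[ x < m ] ∣ fibre p x ∣
∣p∣≡∑∣fibre∣ m {n} p = begin
  ∣ p ∣                                          ≡⟨ ∣p∣≡∑𝟙 p ⟩
  ∑[ v < m * n ] 𝟙 (lookup p v)                  ≡⟨ ∑-combine m (𝟙 ∘ lookup p) ⟩
  ∑[ x < m ] ∑[ j < n ] 𝟙 (lookup p (combine x j))
    ≡⟨ sum-cong-≗ {m} (λ x → ∣tabulate∣≡∑𝟙 {n} (λ j → lookup p (combine x j))) ⟨
  ∑[ x < m ] ∣ fibre p x ∣                       ∎
  where open ≡-Reasoning

least : {P : ℕ → Set} → (∀ l → Dec (P l)) → ∀ {l} → P l → ∃[ l₀ ] (P l₀ × ∀ l → l < l₀ → ¬ P l)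
least P? {l} Pl with P? 0
... | yes P0 = 0 , P0 , λ _ ()
least P? {zero}  Pl | no ¬P0 = contradiction Pl ¬P0
least P? {suc l} Pl | no ¬P0 with least (P? ∘ suc) Pl
... | l₀ , Pl₀ , below = suc l₀ , Pl₀ , λ where
  zero    _         → ¬P0
  (suc l) (s≤s l<l₀) → below l l<l₀

leastFin : ∀ {k} {P : Fin k → Set} → (∀ i → Dec (P i)) → ∀ {i} → P i →
  ∃[ i₀ ] (P i₀ × ∀ i → toℕ i < toℕ i₀ → ¬ P i)
leastFin {suc k} P? {i} Pi with P? zero
... | yes P0 = zero , P0 , λ _ ()
leastFin {suc k} P? {zero}  Pi | no ¬P0 = contradiction Pi ¬P0
leastFin {suc k} P? {suc i} Pi | no ¬P0 with leastFin (P? ∘ suc) Pi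
... | i₀ , Pi₀ , below = suc i₀ , Pi₀ , λ where
  zero    _         → ¬P0
  (suc i) (s≤s i<i₀) → below i i<i₀

∈S⁻ : ∀ {G x} → x ∈ S G → Simplicial G x
∈S⁻ {G} {x} x∈S = isYes⁻ (simplicial? G x) (∈-tabulate⁻ x∈S)

module _ {G : Graph} where

  _++ʷ_ : ∀ {x y z k l} → Walk G x y k → Walk G y z l → Walk G x z (k + l)
  nil _    ++ʷ w = w
  cons e v ++ʷ w = cons e (v ++ʷ w)

  walk0⇒≡ : ∀ {x y} → Walk G x y 0 → x ≡ y
  walk0⇒≡ (nil _) = refl

  walk? : ∀ l x y → Dec (Walk G x y l)
  walk? zero x y with x ≟ y
  ... | yes refl = yes (nil x)
  ... | no  x≢y  = no λ { (nil _) → x≢y refl }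
  walk? (suc l) x y with any? (λ z → (adj G x z Data.Bool.≟ true) ×-dec walk? l z y)
  ... | yes (z , e , w) = yes (cons e w)
  ... | no  ¬w          = no λ { (cons e w) → ¬w (_ , e , w) }

  shortestWalk : Connected G → ∀ x y → ∃[ l ] Σ (Walk G x y l) IsShortest
  shortestWalk connected x y with least (λ l → walk? l x y) (proj₂ (connected x y))
  ... | l , w , below = l , w , λ l' w' → ≮⇒≥ (λ l'<l → below l' l'<l w')

  interior-split : ∀ {x y l v} (w : Walk G x y l) → v ∈ˡ interior w →
    ∃[ p ] ∃[ s ] ∃[ k ] ∃[ k' ]
      (Walk G x p k × Adj G p v × Adj G v s × Walk G s y k' × k + suc (suc k') ≡ l)
  interior-split (cons {x = x} e (cons e' w)) (here refl) = x , _ , 0 , _ , nil x , e , e' , w , refl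
  interior-split (cons e (cons e' w)) (there v∈) with interior-split (cons e' w) v∈
  ... | p , s , k , k' , w₁ , ep , es , w₂ , length =
    p , s , suc k , k' , cons e w₁ , ep , es , w₂ , cong suc length

  -- A simplicial interior vertex could be bypassed through its two (adjacent or equal) neighbours.
  interior-nonSimplicial : IsSimple G → ∀ {x y l v} (w : Walk G x y l) → IsShortest w →
    v ∈ˡ interior w → ¬ Simplicial G v
  interior-nonSimplicial (symmetric , _) w shortest v∈ simplicial with interior-split w v∈
  ... | p , s , k , k' , w₁ , ep , es , w₂ , refl with p ≟ s
  ... | yes refl = <⇒≱ (+-monoʳ-< k (m<n⇒m<1+n (n<1+n k'))) (shortest _ (w₁ ++ʷ w₂))
  ... | no  p≢s  = <⇒≱ (+-monoʳ-< k (n<1+n (suc k')))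
                       (shortest _ (w₁ ++ʷ cons (simplicial p s (trans (symmetric _ _) ep) es p≢s) w₂))

module CartesianK (G : Graph) (n : ℕ) where

  GK : Graph
  GK = G □ K n

  ⟨_,_⟩ : Fin (order G) → Fin n → Fin (order GK)
  ⟨ x , j ⟩ = combine x j

  base : Fin (order GK) → Fin (order G)
  base v = proj₁ (remQuot {order G} n v)

  layer : Fin (order GK) → Fin n
  layer v = proj₂ (remQuot {order G} n v)

  base-⟨⟩ : ∀ x j → base ⟨ x , j ⟩ ≡ x
  base-⟨⟩ x j = cong proj₁ (remQuot-combine x j)

  layer-⟨⟩ : ∀ x j → layer ⟨ x , j ⟩ ≡ j
  layer-⟨⟩ x j = cong proj₂ (remQuot-combine x j)

  ⟨base,layer⟩ : ∀ v → ⟨ base v , layer v ⟩ ≡ v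
  ⟨base,layer⟩ v = combine-remQuot {order G} n v

  SameFibre SameLayer : Fin (order GK) → Fin (order GK) → Set
  SameFibre u v = base u ≡ base v × layer u ≢ layer v
  SameLayer u v = Adj G (base u) (base v) × layer u ≡ layer v

  □-adj⁻ : ∀ {u v} → Adj GK u v → SameFibre u v ⊎ SameLayer u v
  □-adj⁻ {u} {v} e with base u ≟ base v | layer u ≟ layer v | adj G (base u) (base v)
  ... | yes b≡ | no  l≢ | _     = inj₁ (b≡ , l≢)
  ... | _      | yes l≡ | true  = inj₂ (refl , l≡)
  ... | yes _  | yes _  | false with () ← e
  ... | no  _  | yes _  | false with () ← e
  ... | no  _  | no  _  | true  with () ← e
  ... | no  _  | no  _  | false with () ← e

  □-adj⁺ : ∀ {u v} → SameFibre u v ⊎ SameLayer u v → Adj GK u v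
  □-adj⁺ {u} {v} h with base u ≟ base v | layer u ≟ layer v | adj G (base u) (base v)
  ... | yes _  | no  _  | _     = refl
  ... | _      | yes _  | true  = ∨-zeroʳ _
  ... | _      | yes l≡ | false with h
  ...   | inj₁ (_ , l≢) = contradiction l≡ l≢
  ...   | inj₂ (() , _)
  □-adj⁺ h | no b≢ | no l≢ | _ with h
  ...   | inj₁ (b≡ , _) = contradiction b≡ b≢
  ...   | inj₂ (_ , l≡) = contradiction l≡ l≢

  adj-fibre : ∀ x {i j} → i ≢ j → Adj GK ⟨ x , i ⟩ ⟨ x , j ⟩
  adj-fibre x {i} {j} i≢j = □-adj⁺ (inj₁ (trans (base-⟨⟩ x i) (sym (base-⟨⟩ x j)) ,
    λ l≡ → i≢j (trans (sym (layer-⟨⟩ x i)) (trans l≡ (layer-⟨⟩ x j)))))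

  adj-layer : ∀ {x y} j → Adj G x y → Adj GK ⟨ x , j ⟩ ⟨ y , j ⟩
  adj-layer {x} {y} j a = □-adj⁺ (inj₂ (subst₂ (Adj G) (sym (base-⟨⟩ x j)) (sym (base-⟨⟩ y j)) a ,
    trans (layer-⟨⟩ x j) (sym (layer-⟨⟩ y j))))

  lift : ∀ {x y l} → Walk G x y l → ∀ j → Walk GK ⟨ x , j ⟩ ⟨ y , j ⟩ l
  lift (nil x)    j = nil ⟨ x , j ⟩
  lift (cons e w) j = cons (adj-layer j e) (lift w j)

  interior-lift : ∀ {x y l} (w : Walk G x y l) j → interior (lift w j) ≡ map ⟨_, j ⟩ (interior w)
  interior-lift (nil _)                       j = refl
  interior-lift (cons _ (nil _))              j = refl
  interior-lift (cons {y = y} _ (cons e w))   j = cong (⟨ y , j ⟩ ∷_) (interior-lift (cons e w) j)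

  project : ∀ {u v l} → Walk GK u v l →
    ∃[ l' ] (Walk G (base u) (base v) l' × l' ≤ l × (layer u ≢ layer v → l' < l))
  project (nil u) = 0 , nil (base u) , z≤n , λ l≢ → contradiction refl l≢
  project {v = v} (cons e w) with project w | □-adj⁻ e
  ... | l' , w' , l'≤ , _ | inj₁ (b≡ , _) =
    l' , subst (λ z → Walk G z (base v) l') (sym b≡) w' , m≤n⇒m≤1+n l'≤ , λ _ → s≤s l'≤
  ... | l' , w' , l'≤ , l'< | inj₂ (a , l≡) =
    suc l' , cons a w' , s≤s l'≤ , λ l≢ → s≤s (l'< (l≢ ∘ trans l≡))

  project⟨⟩ : ∀ {x y i j l} → Walk GK ⟨ x , i ⟩ ⟨ y , j ⟩ l →
    ∃[ l' ] (Walk G x y l' × l' ≤ l × (i ≢ j → l' < l))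
  project⟨⟩ {x} {y} {i} {j} w with project w
  ... | l' , w' , l'≤ , l'< = l' , subst₂ (λ a b → Walk G a b l') (base-⟨⟩ x i) (base-⟨⟩ y j) w' , l'≤ ,
        λ i≢j → l'< λ l≡ → i≢j (trans (sym (layer-⟨⟩ x i)) (trans l≡ (layer-⟨⟩ y j)))

  lift-shortest : ∀ {x y l} (w : Walk G x y l) → IsShortest w → ∀ j → IsShortest (lift w j)
  lift-shortest _ shortest j l' w' with project⟨⟩ w'
  ... | l'' , w'' , l''≤l' , _ = ≤-trans (shortest l'' w'') l''≤l'

  -- Changing layer costs one extra step on top of the distance in G.
  detour-shortest : ∀ {x y l i j} (w : Walk G x y l) → IsShortest w → i ≢ j →
    (w' : Walk GK ⟨ x , i ⟩ ⟨ y , j ⟩ (suc l)) → IsShortest w'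
  detour-shortest _ shortest i≢j _ l' w' with project⟨⟩ w'
  ... | l'' , w'' , _ , l''<l' = ≤-trans (s≤s (shortest l'' w'')) (l''<l' i≢j)

  flatten : (X : Subset (order GK)) (i : Fin n) → ∀ {u v l} (w : Walk GK u v l) →
    layer u ≡ i → All (_∉ X) (interior w) → ∀ {x y} → base u ≡ x → base v ≡ y →
    (∃[ l' ] (Walk G x y l' × l' < l)) ⊎
    (Σ (Walk G x y l) λ w' → All (λ z → ⟨ z , i ⟩ ∉ X) (interior w'))
  flatten X i (nil u) _ _ refl refl = inj₂ (nil (base u) , [])
  flatten X i {v = v} (cons e w) _ _ refl refl with □-adj⁻ e
  ... | inj₁ (b≡ , _) with project w
  ...   | l' , w' , l'≤ , _ = inj₁ (l' , subst (λ z → Walk G z (base v) l') (sym b≡) w' , s≤s l'≤)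
  flatten X i (cons e (nil _)) _ _ refl refl | inj₂ (a , _) = inj₂ (cons a (nil _) , [])
  flatten X i (cons {y = z} e (cons e' w)) li (z∉X ∷ avoids) refl refl | inj₂ (a , l≡)
    with flatten X i (cons e' w) (trans (sym l≡) li) avoids refl refl
  ... | inj₁ (l' , w' , l'<) = inj₁ (suc l' , cons a w' , s≤s l'<)
  ... | inj₂ (w'@(cons _ _) , avoids') = inj₂ (cons a w' , ⟨z,i⟩∉X ∷ avoids')
    where
    ⟨z,i⟩∉X : ⟨ base z , i ⟩ ∉ X
    ⟨z,i⟩∉X = subst (_∉ X) (trans (sym (⟨base,layer⟩ z)) (cong ⟨ base z ,_⟩ (trans (sym l≡) li))) z∉X

  square-corner : ∀ {x y i j v} → x ≢ y → i ≢ j → Adj GK ⟨ x , i ⟩ v → Adj GK v ⟨ y , j ⟩ →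
    v ≡ ⟨ x , j ⟩ ⊎ v ≡ ⟨ y , i ⟩
  square-corner {x} {y} {i} {j} {v} x≢y i≢j e e' with □-adj⁻ e | □-adj⁻ e'
  ... | inj₁ (b≡ , _) | inj₁ (b≡' , _) =
    contradiction (trans (sym (base-⟨⟩ x i)) (trans b≡ (trans b≡' (base-⟨⟩ y j)))) x≢y
  ... | inj₁ (b≡ , _) | inj₂ (_ , l≡') = inj₁ (trans (sym (⟨base,layer⟩ v))
    (cong₂ ⟨_,_⟩ (trans (sym b≡) (base-⟨⟩ x i)) (trans l≡' (layer-⟨⟩ y j))))
  ... | inj₂ (_ , l≡) | inj₁ (b≡' , _) = inj₂ (trans (sym (⟨base,layer⟩ v))
    (cong₂ ⟨_,_⟩ (trans b≡' (base-⟨⟩ y j)) (trans (sym l≡) (layer-⟨⟩ x i))))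
  ... | inj₂ (_ , l≡) | inj₂ (_ , l≡') =
    contradiction (trans (sym (layer-⟨⟩ x i)) (trans l≡ (trans l≡' (layer-⟨⟩ y j)))) i≢j

-- The summand of twinClassSum is local to its definition, so it enters below only as a
-- metavariable, solved by the use in twinClassSum≡∑ (hence the mutual block).
mutual
  twinClassSum≡∑ : ∀ G n →
    twinClassSum G n ≡ ∑[ g < order G ] (𝟙 (isYes (isRep? G g)) * (∣ TwinClass G g ∣ ⊔ n))
  twinClassSum≡∑ G n = trans (sumˡ-allFin (order G) _) (sum-cong-≗ (twinClassSum-summand G n))

  twinClassSum-summand : ∀ G n g → _ ≡ 𝟙 (isYes (isRep? G g)) * (∣ TwinClass G g ∣ ⊔ n)
  twinClassSum-summand G n g with isRep? G g
  ... | yes _ = sym (*-identityˡ _)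
  ... | no  _ = refl

module Twins (G : Graph) (simple : IsSimple G) where

  private
    adj-sym : ∀ {x y} → Adj G x y → Adj G y x
    adj-sym {x} {y} a = trans (proj₁ simple y x) a

  N[]-adj : ∀ {g u} → u ∈ N[ G ] g → g ≢ u → Adj G g u
  N[]-adj {g} {u} u∈ g≢u = trans (sym (cong (_∨ adj G g u) (isNo⁺ (g ≟ u) g≢u))) (∈-tabulate⁻ u∈)

  adj-N[] : ∀ {g u} → Adj G g u → u ∈ N[ G ] g
  adj-N[] {g} {u} a = ∈-tabulate⁺ (trans (cong (isYes (g ≟ u) ∨_) a) (∨-zeroʳ _))

  self-N[] : ∀ g → g ∈ N[ G ] g
  self-N[] g = ∈-tabulate⁺ (cong (_∨ adj G g g) (isYes⁺ (g ≟ g) refl))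

  twins-adj : ∀ {x y} → TrueTwins G x y → x ≢ y → Adj G x y
  twins-adj {x} {y} tw = N[]-adj (subst (y ∈_) (sym tw) (self-N[] y))

  twins-neighbour : ∀ {x y u} → TrueTwins G x y → y ≢ u → Adj G x u → Adj G y u
  twins-neighbour tw y≢u a = N[]-adj (subst (_ ∈_) tw (adj-N[] a)) y≢u

  twin-simplicial : ∀ {g x} → TrueTwins G g x → Simplicial G x → Simplicial G g
  twin-simplicial {g} {x} tw sx u w au aw u≢w with g ≟ x | u ≟ x | w ≟ x
  ... | yes refl | _        | _        = sx u w au aw u≢w
  ... | no  _    | yes refl | yes refl = contradiction refl u≢w
  ... | no  _    | yes refl | no  w≢x  = twins-neighbour tw (w≢x ∘ sym) aw
  ... | no  _    | no  u≢x  | yes refl = adj-sym (twins-neighbour tw (u≢x ∘ sym) au)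
  ... | no  _    | no  u≢x  | no  w≢x  =
    sx u w (twins-neighbour tw (u≢x ∘ sym) au) (twins-neighbour tw (w≢x ∘ sym) aw) u≢w

  simplicial-N[]⊆ : ∀ {x y} → Simplicial G x → Adj G x y → N[ G ] x ⊆ N[ G ] y
  simplicial-N[]⊆ {x} {y} sx a {u} u∈ with y ≟ u | x ≟ u
  ... | yes refl | _        = self-N[] y
  ... | no  _    | yes refl = adj-N[] (adj-sym a)
  ... | no  y≢u  | no  x≢u  = adj-N[] (sx y u a (N[]-adj u∈ x≢u) y≢u)

  adj-simplicial⇒twins : ∀ {x y} → Simplicial G x → Simplicial G y → Adj G x y → TrueTwins G x y
  adj-simplicial⇒twins sx sy a = ⊆-antisym (simplicial-N[]⊆ sx a) (simplicial-N[]⊆ sy (adj-sym a))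

  ∈TwinClass⁻ : ∀ {g x} → x ∈ TwinClass G g → Simplicial G x × TrueTwins G g x
  ∈TwinClass⁻ {g} {x} x∈ with simplicial? G x | twins? G g x | ∈-tabulate⁻ x∈
  ... | yes s | yes t | _ = s , t

  ∈TwinClass⁺ : ∀ {g x} → Simplicial G x → TrueTwins G g x → x ∈ TwinClass G g
  ∈TwinClass⁺ {g} {x} s t =
    ∈-tabulate⁺ (cong₂ _∧_ (isYes⁺ (simplicial? G x) s) (isYes⁺ (twins? G g x) t))

  TwinClass-cong : ∀ {g g'} → TrueTwins G g g' → TwinClass G g ≡ TwinClass G g'
  TwinClass-cong tw = ⊆-antisym (move tw) (move (sym tw))
    where
    move : ∀ {g g'} → TrueTwins G g g' → TwinClass G g ⊆ TwinClass G g'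
    move tw x∈ with ∈TwinClass⁻ x∈
    ... | s , t = ∈TwinClass⁺ s (trans (sym tw) t)

  IsRep-unique : ∀ {g g'} → IsRep G g → IsRep G g' → TrueTwins G g g' → g ≡ g'
  IsRep-unique {g} {g'} (_ , minimal) (_ , minimal') tw with <-cmp g g'
  ... | tri< g<g' _ _ = contradiction (sym tw) (minimal' g g<g')
  ... | tri≈ _ g≡g' _ = g≡g'
  ... | tri> _ _ g'<g = contradiction tw (minimal g' g'<g)

  ∃IsRep : ∀ {x} → Simplicial G x → ∃[ g ] (IsRep G g × TrueTwins G g x)
  ∃IsRep {x} sx with leastFin (λ g → twins? G g x) {x} refl
  ... | g , tw , below =
    g , (twin-simplicial tw sx , λ g' g'<g tw' → below g' g'<g (trans (sym tw') tw)) , tw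

  isRepᵇ : Fin (order G) → Bool
  isRepᵇ g = isYes (isRep? G g)

  ∑-twinClasses : (r : Fin (order G) → ℕ) → (∀ x → ¬ Simplicial G x → r x ≡ 0) →
    ∑[ x < order G ] r x ≡
    ∑[ g < order G ] (𝟙 (isRepᵇ g) * ∑[ x < order G ] (𝟙 (lookup (TwinClass G g) x) * r x))
  ∑-twinClasses r vanish = ∑-partition isRepᵇ (TwinClass G) r classify
    where
    classify : ∀ x → 0 < r x → ∃[ g ] (isRepᵇ g ≡ true × x ∈ TwinClass G g ×
                 ∀ g' → isRepᵇ g' ≡ true → x ∈ TwinClass G g' → g' ≡ g)
    classify x 0<rx with simplicial? G x
    ... | no ¬s = contradiction (vanish x ¬s) (>⇒≢ 0<rx)
    ... | yes s with ∃IsRep s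
    ...   | g , rep , tw = g , isYes⁺ (isRep? G g) rep , ∈TwinClass⁺ s tw , λ g' rep' x∈ →
      IsRep-unique (isYes⁻ (isRep? G g') rep') rep (trans (proj₂ (∈TwinClass⁻ x∈)) (sym tw))

module UpperBound (G : Graph) (simple : IsSimple G) (n : ℕ)
    (S-maximal : ∀ Y → IsTotalMutualVisibility G Y → ∣ Y ∣ ≤ ∣ S G ∣)
    (X : Subset (order (G □ K n))) (X-visible : IsTotalMutualVisibility (G □ K n) X) where

  open CartesianK G n
  open Twins G simple

  layerSet : Fin n → Subset (order G)
  layerSet i = tabulate (λ x → lookup X ⟨ x , i ⟩)

  ∈layerSet⁻ : ∀ {z i} → z ∈ layerSet i → ⟨ z , i ⟩ ∈ X
  ∈layerSet⁻ {z} {i} z∈ = lookup⇒[]= ⟨ z , i ⟩ X (∈-tabulate⁻ z∈)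

  layerSet∪S-visible : ∀ i → IsTotalMutualVisibility G (layerSet i ∪ S G)
  layerSet∪S-visible i x y with X-visible ⟨ x , i ⟩ ⟨ y , i ⟩
  ... | l , w , shortest , avoids with flatten X i w (layer-⟨⟩ x i) avoids (base-⟨⟩ x i) (base-⟨⟩ y i)
  ...   | inj₁ (l' , w' , l'<l) = contradiction (shortest l' (lift w' i)) (<⇒≱ l'<l)
  ...   | inj₂ (w' , avoids') = l , w' , shortest' , All.tabulate ∉layerSet∪S
    where
    shortest' : IsShortest w'
    shortest' l'' w'' = shortest l'' (lift w'' i)
    ∉layerSet∪S : ∀ {z} → z ∈ˡ interior w' → z ∉ layerSet i ∪ S G
    ∉layerSet∪S z∈ z∈Y with x∈p∪q⁻ (layerSet i) (S G) z∈Y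
    ... | inj₁ z∈layer = All.lookup avoids' z∈ (∈layerSet⁻ z∈layer)
    ... | inj₂ z∈S     = interior-nonSimplicial simple w' shortest' z∈ (∈S⁻ z∈S)

  ∈X⇒simplicial : ∀ {x i} → ⟨ x , i ⟩ ∈ X → Simplicial G x
  ∈X⇒simplicial {x} {i} xi∈X with simplicial? G x
  ... | yes s = s
  ... | no ¬s = contradiction (S-maximal _ (layerSet∪S-visible i)) (<⇒≱ (p⊂q⇒∣p∣<∣q∣ S⊂))
    where
    S⊂ : S G ⊂ layerSet i ∪ S G
    S⊂ = q⊆p∪q (layerSet i) (S G) , x , x∈p∪q⁺ (inj₁ (∈-tabulate⁺ ([]=⇒lookup xi∈X))) , ¬s ∘ ∈S⁻

  -- Both shortest ⟨x,j⟩,⟨y,i⟩-paths pass through ⟨x,i⟩ or ⟨y,j⟩.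
  no-diagonal : ∀ {x y i j} → x ≢ y → Adj G x y → i ≢ j → ⟨ x , i ⟩ ∈ X → ⟨ y , j ⟩ ∈ X → ⊥
  no-diagonal {x} {y} {i} {j} x≢y a i≢j xi∈X yj∈X with X-visible ⟨ x , j ⟩ ⟨ y , i ⟩
  ... | l , w , shortest , avoids = blocked w (shortest 2 square) avoids
    where
    square : Walk GK ⟨ x , j ⟩ ⟨ y , i ⟩ 2
    square = cons (adj-fibre x (i≢j ∘ sym)) (cons (adj-layer i a) (nil _))
    too-short : ∀ {l} → Walk GK ⟨ x , j ⟩ ⟨ y , i ⟩ l → l ≤ 1 → ⊥
    too-short w l≤1 with project⟨⟩ w
    ... | zero  , w' , _ , _   = x≢y (walk0⇒≡ w')
    ... | suc _ , _  , _ , l'< = contradiction (≤-trans (l'< (i≢j ∘ sym)) l≤1) λ { (s≤s ()) }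
    blocked : ∀ {l} (w : Walk GK ⟨ x , j ⟩ ⟨ y , i ⟩ l) → l ≤ 2 → All (_∉ X) (interior w) → ⊥
    blocked {0} w _ _ = too-short w z≤n
    blocked {1} w _ _ = too-short w ≤-refl
    blocked {2} (cons e (cons e' (nil _))) _ (v∉X ∷ []) with square-corner x≢y (i≢j ∘ sym) e e'
    ... | inj₁ refl = v∉X xi∈X
    ... | inj₂ refl = v∉X yj∈X
    blocked {suc (suc (suc _))} _ (s≤s (s≤s ())) _

  fibre-exclusive : ∀ {x y} → x ≢ y → Adj G x y → 0 < ∣ fibre X y ∣ → ∣ fibre X x ∣ ≤ 1
  fibre-exclusive {x} {y} x≢y a 0< with Nonempty-∣p∣ (fibre X y) 0<
  ... | k , k∈ = ≤-trans (p⊆q⇒∣p∣≤∣q∣ ⊆⁅k⁆) (≤-reflexive (∣⁅x⁆∣≡1 k))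
    where
    ⊆⁅k⁆ : fibre X x ⊆ ⁅ k ⁆
    ⊆⁅k⁆ {j} j∈ with j ≟ k
    ... | yes refl = x∈⁅x⁆ k
    ... | no  j≢k  = ⊥-elim (no-diagonal x≢y a j≢k (∈-fibre⁻ {p = X} {x} j∈) (∈-fibre⁻ {p = X} {y} k∈))

  ∣X∣≤twinClassSum : ∣ X ∣ ≤ twinClassSum G n
  ∣X∣≤twinClassSum = begin
    ∣ X ∣                                                              ≡⟨ ∣p∣≡∑∣fibre∣ (order G) X ⟩
    ∑[ x < order G ] r x                                               ≡⟨ ∑-twinClasses r r-vanish ⟩
    ∑[ g < order G ] (𝟙 (isRepᵇ g) * ∑[ x < order G ] (𝟙 (lookup (TwinClass G g) x) * r x))
      ≤⟨ ∑-mono-≤ (λ g → *-monoʳ-≤ (𝟙 (isRepᵇ g)) (class-bound g)) ⟩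
    ∑[ g < order G ] (𝟙 (isRepᵇ g) * (∣ TwinClass G g ∣ ⊔ n))         ≡⟨ twinClassSum≡∑ G n ⟨
    twinClassSum G n                                                   ∎
    where
    open ≤-Reasoning
    r : Fin (order G) → ℕ
    r x = ∣ fibre X x ∣
    r-vanish : ∀ x → ¬ Simplicial G x → r x ≡ 0
    r-vanish x ¬s = Empty⇒∣p∣≡0 (fibre X x) λ j j∈ → ¬s (∈X⇒simplicial (∈-fibre⁻ {p = X} {x} j∈))
    exclusive : ∀ {g} x y → x ∈ TwinClass G g → y ∈ TwinClass G g → x ≢ y → 0 < r y → r x ≤ 1
    exclusive x y x∈ y∈ x≢y = fibre-exclusive x≢y
      (twins-adj (trans (sym (proj₂ (∈TwinClass⁻ x∈))) (proj₂ (∈TwinClass⁻ y∈))) x≢y)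
    class-bound : ∀ g → ∑[ x < order G ] (𝟙 (lookup (TwinClass G g) x) * r x) ≤ ∣ TwinClass G g ∣ ⊔ n
    class-bound g = ∑-class-≤ (TwinClass G g) r (λ x → ∣p∣≤n (fibre X x)) exclusive

module LowerBound (G : Graph) (simple : IsSimple G) (connected : Connected G) (n : ℕ) (j₀ : Fin n) where

  open CartesianK G n
  open Twins G simple

  InX : Fin (order G) → Fin n → Set
  InX x j = (Simplicial G x × n ≤ ∣ TwinClass G x ∣ × j ≡ j₀) ⊎ (IsRep G x × ∣ TwinClass G x ∣ < n)

  InX? : ∀ x j → Dec (InX x j)
  InX? x j = (simplicial? G x ×-dec (n ≤? ∣ TwinClass G x ∣) ×-dec (j ≟ j₀))
             ⊎-dec (isRep? G x ×-dec (suc ∣ TwinClass G x ∣ ≤? n))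

  X : Subset (order GK)
  X = tabulate (λ v → isYes (InX? (base v) (layer v)))

  lookup-X : ∀ x j → lookup X ⟨ x , j ⟩ ≡ isYes (InX? x j)
  lookup-X x j = trans (lookup∘tabulate _ ⟨ x , j ⟩)
                       (cong₂ (λ y i → isYes (InX? y i)) (base-⟨⟩ x j) (layer-⟨⟩ x j))

  ∈X⁺ : ∀ {x j} → InX x j → ⟨ x , j ⟩ ∈ X
  ∈X⁺ {x} {j} h = lookup⇒[]= ⟨ x , j ⟩ X (trans (lookup-X x j) (isYes⁺ (InX? x j) h))

  ∈X⁻ : ∀ x j → ⟨ x , j ⟩ ∈ X → InX x j
  ∈X⁻ x j xj∈X = isYes⁻ (InX? x j) (trans (sym (lookup-X x j)) ([]=⇒lookup xj∈X))

  InX⇒simplicial : ∀ {x j} → InX x j → Simplicial G x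
  InX⇒simplicial (inj₁ (s , _))         = s
  InX⇒simplicial (inj₂ ((s , _) , _))   = s

  nonSimplicial∉X : ∀ {x j} → ¬ Simplicial G x → ⟨ x , j ⟩ ∉ X
  nonSimplicial∉X {x} {j} ¬s = ¬s ∘ InX⇒simplicial ∘ ∈X⁻ x j

  clash : ∀ {x y i j} → Adj G x y → i ≢ j → InX x j → InX y i → ⊥
  clash {x} {y} {i} {j} a i≢j hx hy = clash′ hx hy
    where
    sameClass : ∣ TwinClass G x ∣ ≡ ∣ TwinClass G y ∣
    sameClass =
      cong ∣_∣ (TwinClass-cong (adj-simplicial⇒twins (InX⇒simplicial hx) (InX⇒simplicial hy) a))
    clash′ : InX x j → InX y i → ⊥
    clash′ (inj₁ (_ , _ , j≡j₀)) (inj₁ (_ , _ , i≡j₀)) = i≢j (trans i≡j₀ (sym j≡j₀))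
    clash′ (inj₁ (_ , n≤ , _)) (inj₂ (_ , <n)) = <⇒≱ <n (subst (n ≤_) sameClass n≤)
    clash′ (inj₂ (_ , <n)) (inj₁ (_ , n≤ , _)) = <⇒≱ <n (subst (n ≤_) (sym sameClass) n≤)
    clash′ (inj₂ (rx , _)) (inj₂ (ry , _)) with IsRep-unique rx ry
      (adj-simplicial⇒twins (proj₁ rx) (proj₁ ry) a)
    ... | refl with () ← trans (sym (proj₂ simple x)) a

  lift-avoids : ∀ {x y l} (w : Walk G x y l) j → (∀ {z} → z ∈ˡ interior w → ¬ Simplicial G z) →
    All (_∉ X) (interior (lift w j))
  lift-avoids w j nonSimplicial =
    subst (All (_∉ X)) (sym (interior-lift w j))
          (Allₚ.map⁺ (All.tabulate (nonSimplicial∉X ∘ nonSimplicial)))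

  within-layer : ∀ {x y l} (w : Walk G x y l) → IsShortest w → ∀ i → Visible GK X ⟨ x , i ⟩ ⟨ y , i ⟩
  within-layer w shortest i =
    _ , lift w i , lift-shortest w shortest i ,
    lift-avoids w i (interior-nonSimplicial simple w shortest)

  detour-visible : ∀ {x y l i j} (w : Walk G x y l) → IsShortest w → i ≢ j →
    (w' : Walk GK ⟨ x , i ⟩ ⟨ y , j ⟩ (suc l)) → All (_∉ X) (interior w') →
    Visible GK X ⟨ x , i ⟩ ⟨ y , j ⟩
  detour-visible w shortest i≢j w' avoids = _ , w' , detour-shortest w shortest i≢j w' , avoids

  across-layers : ∀ {x y l i j} (w : Walk G x y l) → IsShortest w → i ≢ j →
    Visible GK X ⟨ x , i ⟩ ⟨ y , j ⟩
  across-layers {x} w@(nil _) shortest i≢j =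
    detour-visible w shortest i≢j (cons (adj-fibre x i≢j) (nil _)) []
  across-layers {x} {y} {i = i} {j} w@(cons e (nil _)) shortest i≢j with ⟨ x , j ⟩ ∈? X | ⟨ y , i ⟩ ∈? X
  ... | no xj∉X  | _        =
    detour-visible w shortest i≢j (cons (adj-fibre x i≢j) (cons (adj-layer j e) (nil _))) (xj∉X ∷ [])
  ... | yes _    | no yi∉X  =
    detour-visible w shortest i≢j (cons (adj-layer i e) (cons (adj-fibre y i≢j) (nil _))) (yi∉X ∷ [])
  ... | yes xj∈X | yes yi∈X = ⊥-elim (clash e i≢j (∈X⁻ x j xj∈X) (∈X⁻ y i yi∈X))
  across-layers {i = i} {j} w@(cons {y = z} e w'@(cons _ _)) shortest i≢j =
    detour-visible w shortest i≢j (cons (adj-layer i e) (cons (adj-fibre z i≢j) (lift w' j)))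
      (nonSimplicial∉X z-nonSimplicial ∷ nonSimplicial∉X z-nonSimplicial ∷
       lift-avoids w' j (nonSimplicial ∘ there))
    where
    nonSimplicial : ∀ {v} → v ∈ˡ interior w → ¬ Simplicial G v
    nonSimplicial = interior-nonSimplicial simple w shortest
    z-nonSimplicial : ¬ Simplicial G z
    z-nonSimplicial = nonSimplicial (here refl)

  X-visible : IsTotalMutualVisibility GK X
  X-visible u v = subst₂ (Visible GK X) (⟨base,layer⟩ u) (⟨base,layer⟩ v)
                         (visible⟨⟩ (base u) (layer u) (base v) (layer v))
    where
    visible⟨⟩ : ∀ x i y j → Visible GK X ⟨ x , i ⟩ ⟨ y , j ⟩
    visible⟨⟩ x i y j with shortestWalk connected x y | i ≟ j
    ... | _ , w , shortest | yes refl = within-layer w shortest i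
    ... | _ , w , shortest | no  i≢j = across-layers w shortest i≢j

  ∣fibre∣-large : ∀ {x} → Simplicial G x → n ≤ ∣ TwinClass G x ∣ → ∣ fibre X x ∣ ≡ 1
  ∣fibre∣-large {x} s n≤ = trans (cong ∣_∣ (⊆-antisym ⊆⁅j₀⁆ ⁅j₀⁆⊆)) (∣⁅x⁆∣≡1 j₀)
    where
    ⊆⁅j₀⁆ : fibre X x ⊆ ⁅ j₀ ⁆
    ⊆⁅j₀⁆ {j} j∈ with ∈X⁻ x j (∈-fibre⁻ {p = X} {x} j∈)
    ... | inj₁ (_ , _ , refl) = x∈⁅x⁆ j₀
    ... | inj₂ (_ , <n)       = contradiction n≤ (<⇒≱ <n)
    ⁅j₀⁆⊆ : ⁅ j₀ ⁆ ⊆ fibre X x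
    ⁅j₀⁆⊆ {j} j∈ rewrite x∈⁅y⁆⇒x≡y j₀ j∈ = ∈-fibre⁺ {p = X} {x} (∈X⁺ (inj₁ (s , n≤ , refl)))

  ∣fibre∣-rep : ∀ {x} → IsRep G x → ∣ TwinClass G x ∣ < n → ∣ fibre X x ∣ ≡ n
  ∣fibre∣-rep {x} rep <n =
    trans (cong ∣_∣ (⊆-antisym {i = fibre X x} ⊆⊤ λ {j} _ → ∈-fibre⁺ {p = X} {x} {j} (∈X⁺ (inj₂ (rep , <n)))))
          (∣⊤∣≡n n)

  ∣fibre∣-nonRep : ∀ {x} → ¬ IsRep G x → ∣ TwinClass G x ∣ < n → ∣ fibre X x ∣ ≡ 0
  ∣fibre∣-nonRep {x} ¬rep <n = Empty⇒∣p∣≡0 (fibre X x) λ j j∈ →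
    case ∈X⁻ x j (∈-fibre⁻ {p = X} {x} j∈) of λ where
    (inj₁ (_ , n≤ , _)) → <⇒≱ <n n≤
    (inj₂ (rep , _))    → ¬rep rep

  ∑∣fibre∣-twinClass : ∀ {g} → IsRep G g →
    ∑[ x < order G ] (𝟙 (lookup (TwinClass G g) x) * ∣ fibre X x ∣) ≡ ∣ TwinClass G g ∣ ⊔ n
  ∑∣fibre∣-twinClass {g} rep with n ≤? ∣ TwinClass G g ∣
  ... | yes n≤ = begin
    ∑[ x < order G ] (𝟙 (lookup (TwinClass G g) x) * ∣ fibre X x ∣) ≡⟨ sum-cong-≗ one ⟩
    ∑[ x < order G ] 𝟙 (lookup (TwinClass G g) x)                   ≡⟨ ∣p∣≡∑𝟙 (TwinClass G g) ⟨
    ∣ TwinClass G g ∣                                                ≡⟨ m≥n⇒m⊔n≡m n≤ ⟨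
    ∣ TwinClass G g ∣ ⊔ n                                            ∎
    where
    open ≡-Reasoning
    one : ∀ x → 𝟙 (lookup (TwinClass G g) x) * ∣ fibre X x ∣ ≡ 𝟙 (lookup (TwinClass G g) x)
    one x with lookup (TwinClass G g) x in x∈
    ... | false = refl
    ... | true with ∈TwinClass⁻ (lookup⇒[]= x (TwinClass G g) x∈)
    ...   | s , tw =
      trans (*-identityˡ _) (∣fibre∣-large s (subst (λ C → n ≤ ∣ C ∣) (TwinClass-cong tw) n≤))
  ... | no n≰ = trans (∑-single g others) (trans at-g (sym (m≤n⇒m⊔n≡n (<⇒≤ <n))))
    where
    <n : ∣ TwinClass G g ∣ < n
    <n = ≰⇒> n≰
    at-g : 𝟙 (lookup (TwinClass G g) g) * ∣ fibre X g ∣ ≡ n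
    at-g rewrite []=⇒lookup (∈TwinClass⁺ {g} (proj₁ rep) refl) =
      trans (*-identityˡ _) (∣fibre∣-rep rep <n)
    others : ∀ x → x ≢ g → 𝟙 (lookup (TwinClass G g) x) * ∣ fibre X x ∣ ≡ 0
    others x x≢g with lookup (TwinClass G g) x in x∈
    ... | false = refl
    ... | true with ∈TwinClass⁻ (lookup⇒[]= x (TwinClass G g) x∈)
    ...   | _ , tw = trans (*-identityˡ _)
      (∣fibre∣-nonRep (λ repx → x≢g (IsRep-unique repx rep (sym tw)))
                      (subst (λ C → ∣ C ∣ < n) (TwinClass-cong tw) <n))

  ∣X∣≡twinClassSum : ∣ X ∣ ≡ twinClassSum G n
  ∣X∣≡twinClassSum = begin
    ∣ X ∣                                                              ≡⟨ ∣p∣≡∑∣fibre∣ (order G) X ⟩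
    ∑[ x < order G ] ∣ fibre X x ∣
      ≡⟨ ∑-twinClasses (λ x → ∣ fibre X x ∣) vanish ⟩
    ∑[ g < order G ] (𝟙 (isRepᵇ g) * ∑[ x < order G ] (𝟙 (lookup (TwinClass G g) x) * ∣ fibre X x ∣))
      ≡⟨ sum-cong-≗ (λ g → 𝟙*-cong (isRepᵇ g) (∑∣fibre∣-twinClass ∘ isYes⁻ (isRep? G g))) ⟩
    ∑[ g < order G ] (𝟙 (isRepᵇ g) * (∣ TwinClass G g ∣ ⊔ n))         ≡⟨ twinClassSum≡∑ G n ⟨
    twinClassSum G n                                                   ∎
    where
    open ≡-Reasoning
    vanish : ∀ x → ¬ Simplicial G x → ∣ fibre X x ∣ ≡ 0
    vanish x ¬s = Empty⇒∣p∣≡0 (fibre X x) λ j j∈ → nonSimplicial∉X ¬s (∈-fibre⁻ {p = X} {x} j∈)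

theorem5p9 : (G : Graph) → IsSimple G → Connected G →
    MuT≡ G ∣ S G ∣ →
    (n : ℕ) → 2 ≤ n →
    MuT≡ (G □ K n) (twinClassSum G n)
theorem5p9 G simple connected (_ , S-maximal) n@(suc _) _ =
  (X , X-visible , ∣X∣≡twinClassSum) ,
  λ Y Y-visible → UpperBound.∣X∣≤twinClassSum G simple n S-maximal Y Y-visible
  where open LowerBound G simple connected n zero
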